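{- For every integer $N\geq 1$, the number of tuples $(\mu_1,\dots,\mu_4;d_1,\dots,d_4)\in P^4\times\mathbb Z^4$ with $d_1+d_2+d_3+d_4$ odd and $$14\sum_{i=1}^{4}|\mu_i|+14\sum_{i=1}^{4}\binom{d_i}{2}+d_1+3d_2+5d_3+7d_4=N$$ equals the number of tuples $(\alpha_1,\dots,\alpha_4;e_1,\dots,e_4)\in P^4\times\mathbb Z^4$ with $e_1+e_2+e_3+e_4$ odd and $$14\sum_{i=1}^{4}|\alpha_i|+14\sum_{i=1}^{4}\binom{e_i}{2}+0e_1+2e_2+4e_3+6e_4+1=N.$$
   Context: $P$ denotes the set of all integer partitions into positive parts (including the empty partition); $|\nu|$ is the sum of the parts of $\nu$. For $d\in\mathbb Z$, $\binom{d}{2}=d(d-1)/2$. -}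

module Defs where

open import Data.Nat as ℕ using (ℕ; zero; suc; _≥_; _≤_; _%_)
open import Data.Nat.Combinatorics using (_C_)
open import Data.Integer as ℤ using (ℤ; +_; -[1+_]; ∣_∣)
open import Data.List using (List)
open import Data.Nat.ListAction using (sum)
open import Data.List.Relation.Unary.All using (All)
open import Data.List.Relation.Unary.Linked using (Linked)
open import Data.Product using (Σ; _×_)
open import Relation.Binary.PropositionalEquality using (_≡_)

Partition : Set
Partition = Σ (List ℕ) (λ l → Linked _≥_ l × All (λ x → 1 ≤ x) l)

size : Partition → ℕ
size ν = sum (Data.Product.proj₁ ν)

-- binom d 2 = d(d-1)/2 for d ∈ ℤ.
-- For d = -(n+1): (-(n+1))(-(n+2))/2 = (n+2 choose 2).
choose2 : ℤ → ℤ
choose2 (+ n) = + (n C 2)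
choose2 (-[1+ n ]) = + (suc (suc n) C 2)

OddZ : ℤ → Set
OddZ z = ∣ z ∣ % 2 ≡ 1

Tuples : ℤ → ℤ → ℤ → ℤ → ℤ → ℕ → Set
Tuples c₀ c₁ c₂ c₃ c₄ N =
  Σ (Partition × Partition × Partition × Partition × ℤ × ℤ × ℤ × ℤ)
    (λ { (μ₁ Data.Product., μ₂ Data.Product., μ₃ Data.Product., μ₄ Data.Product.,
          d₁ Data.Product., d₂ Data.Product., d₃ Data.Product., d₄) →
        OddZ (d₁ ℤ.+ d₂ ℤ.+ d₃ ℤ.+ d₄) ×
        (+ 14 ℤ.* + (size μ₁ ℕ.+ size μ₂ ℕ.+ size μ₃ ℕ.+ size μ₄)
          ℤ.+ + 14 ℤ.* (choose2 d₁ ℤ.+ choose2 d₂ ℤ.+ choose2 d₃ ℤ.+ choose2 d₄)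
          ℤ.+ c₁ ℤ.* d₁ ℤ.+ c₂ ℤ.* d₂ ℤ.+ c₃ ℤ.* d₃ ℤ.+ c₄ ℤ.* d₄ ℤ.+ c₀
          ≡ + N) })

module Submission where

-- If Σdᵢ = 2k+1, subtracting k from every dᵢ gives a tuple with
-- Σ = 2(-k)+1, so this shift is an involution on tuples with odd Σdᵢ.  Using
-- 2·binom(d,2) = d² - d, the fact that it carries the first weight to the
-- second becomes a polynomial identity modulo Σdᵢ - (2k+1); an involution
-- exchanging two predicates restricts to a bijection between them.
--
-- In the first weight every summand 14|μ|, 14·binom(d,2) + c·d
-- (c = 1,3,5,7) is a natural number bounding |μ| resp. |d|, so all solutions
-- occur in an explicit finite list; a type with decidable equality whose
-- elements are all listed is in bijection with some Fin k.

open import Defs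
open import Data.Nat using (ℕ; _≥_)
open import Data.Integer using (+_)
open import Data.Fin using (Fin)
open import Data.Product using (Σ; _×_)
open import Function.Bundles using (_↔_)

open import Data.Nat as ℕ using (zero; suc; _≤_; _<_; z≤n; s≤s; NonZero)
import Data.Nat.Properties as ℕ
open import Data.Nat.Combinatorics using (_C_; nCk+nC[k+1]≡[n+1]C[k+1]; nC1≡n)
open import Data.Nat.DivMod using (_/_; _%_; m≡m%n+[m/n]*n; [m+kn]%n≡m%n)
open import Data.Nat.ListAction using (sum)
import Data.Nat.Tactic.RingSolver as ℕ-Ring
open import Data.Integer as ℤ using (ℤ; -[1+_]; ∣_∣; _+_; _*_; _-_; -_)
import Data.Integer.Properties as ℤ
import Data.Integer.Tactic.RingSolver as ℤ-Ring
open import Data.Fin using (zero; suc)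
open import Data.List
  using (List; []; _∷_; length; lookup; deduplicate; map; _++_; upTo; cartesianProduct; cartesianProductWith)
import Data.List.Properties as List
open import Data.List.Membership.Propositional using (_∈_)
open import Data.List.Membership.Propositional.Properties
  using (∈-lookup; ∈-deduplicate⁺; ∈-upTo⁺; ∈-cartesianProductWith⁺; ∈-cartesianProduct⁺; ∈-map⁺; ∈-++⁺ˡ; ∈-++⁺ʳ)
import Data.List.Membership.Setoid.Properties as SetoidMembership
open import Data.List.Relation.Unary.All as All using (All; []; _∷_; all?)
open import Data.List.Relation.Unary.Any using (here; there; index)
open import Data.List.Relation.Unary.Any.Properties using (lookup-index)
open import Data.List.Relation.Unary.Linked as Linked using (Linked; linked?)
open import Data.List.Relation.Unary.Unique.Propositional using (Unique)
open import Data.List.Relation.Unary.Unique.DecPropositional.Properties using (deduplicate-!)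
open import Data.Product using (_,_; proj₁; proj₂; ∃-syntax)
import Data.Product.Properties as Product
open import Data.Empty using (⊥-elim)
open import Relation.Nullary using (yes; no)
open import Relation.Nullary.Decidable using (_×-dec_)
open import Relation.Unary using (Decidable; Irrelevant)
open import Relation.Binary.Definitions using (DecidableEquality)
open import Relation.Binary.PropositionalEquality
open import Axiom.UniquenessOfIdentityProofs using (module Decidable⇒UIP)
open import Function.Bundles using (mk↔ₛ′)
open import Function.Properties.Inverse using (↔-trans; ↔-sym)

index-∈-lookup : ∀ {A : Set} (xs : List A) (i : Fin (length xs)) → index (∈-lookup {xs = xs} i) ≡ i
index-∈-lookup (x ∷ xs) zero    = refl
index-∈-lookup (x ∷ xs) (suc i) = cong suc (index-∈-lookup xs i)

listed⇒finite : ∀ {A : Set} → DecidableEquality A → (xs : List A) → (∀ x → x ∈ xs) →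
                ∃[ k ] (A ↔ Fin k)
listed⇒finite {A} _≟_ xs listed = length ys , mk↔ₛ′ position (lookup ys) position-lookup lookup-position
  where
  ys : List A
  ys = deduplicate _≟_ xs

  ys-unique : Unique ys
  ys-unique = deduplicate-! _≟_ xs

  ∈ys : ∀ x → x ∈ ys
  ∈ys x = ∈-deduplicate⁺ _≟_ (listed x)

  position : A → Fin (length ys)
  position x = index (∈ys x)

  ∈ys-unique : ∀ {x} (p q : x ∈ ys) → p ≡ q
  ∈ys-unique = SetoidMembership.unique⇒irrelevant (setoid A) (Decidable⇒UIP.≡-irrelevant _≟_) ys-unique

  position-lookup : ∀ i → position (lookup ys i) ≡ i
  position-lookup i = trans (cong index (∈ys-unique (∈ys (lookup ys i)) (∈-lookup i))) (index-∈-lookup ys i)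

  lookup-position : ∀ x → lookup ys (position x) ≡ x
  lookup-position x = sym (lookup-index (∈ys x))

module Subtype {A : Set} {P : A → Set} (P? : Decidable P) (P-irrelevant : Irrelevant P) where

  filterΣ : List A → List (Σ A P)
  filterΣ [] = []
  filterΣ (x ∷ xs) with P? x
  ... | yes px = (x , px) ∷ filterΣ xs
  ... | no _   = filterΣ xs

  ∈-filterΣ : ∀ {x xs} (px : P x) → x ∈ xs → (x , px) ∈ filterΣ xs
  ∈-filterΣ {x} {y ∷ xs} px (here refl) with P? y
  ... | yes py  = here (cong (x ,_) (P-irrelevant px py))
  ... | no ¬py  = ⊥-elim (¬py px)
  ∈-filterΣ {x} {y ∷ xs} px (there x∈xs) with P? y
  ... | yes _ = there (∈-filterΣ px x∈xs)
  ... | no _  = ∈-filterΣ px x∈xs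

  ≡-decΣ : DecidableEquality A → DecidableEquality (Σ A P)
  ≡-decΣ _≟_ = Product.≡-dec _≟_ (λ p q → yes (P-irrelevant p q))

  subtype-finite : DecidableEquality A → (xs : List A) → (∀ {x} → P x → x ∈ xs) →
                   ∃[ k ] (Σ A P ↔ Fin k)
  subtype-finite _≟_ xs covers =
    listed⇒finite (≡-decΣ _≟_) (filterΣ xs) (λ (x , px) → ∈-filterΣ px (covers px))

involution-bijection : ∀ {A : Set} {P Q : A → Set} (f : A → A) →
  Irrelevant P → Irrelevant Q →
  (∀ x → P x → Q (f x)) → (∀ x → Q x → P (f x)) →
  (∀ x → P x → f (f x) ≡ x) → (∀ x → Q x → f (f x) ≡ x) →
  Σ A P ↔ Σ A Q
involution-bijection {A} {P} {Q} f P-irr Q-irr P→Q Q→P invP invQ =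
  mk↔ₛ′ (λ (x , px) → f x , P→Q x px) (λ (x , qx) → f x , Q→P x qx)
        (λ (x , qx) → Σ-≡ Q-irr (invQ x qx)) (λ (x , px) → Σ-≡ P-irr (invP x px))
  where
  Σ-≡ : ∀ {R : A → Set} → Irrelevant R → ∀ {x y} {r : R x} {s : R y} → x ≡ y → (x , r) ≡ (y , s)
  Σ-≡ R-irr refl = cong (_ ,_) (R-irr _ _)

boundedLists : ℕ → ℕ → List (List ℕ)
boundedLists zero    m = [] ∷ []
boundedLists (suc n) m = [] ∷ cartesianProductWith _∷_ (upTo (suc m)) (boundedLists n m)

∈-boundedLists : ∀ {n m} (l : List ℕ) → length l ≤ n → All (_≤ m) l → l ∈ boundedLists n m
∈-boundedLists {zero}  []      _         _        = here refl
∈-boundedLists {suc n} []      _         _        = here refl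
∈-boundedLists {suc n} (x ∷ l) (s≤s len) (x≤m ∷ l≤m) =
  there (∈-cartesianProductWith⁺ _∷_ (∈-upTo⁺ (s≤s x≤m)) (∈-boundedLists l len l≤m))

IsPartition : List ℕ → Set
IsPartition l = Linked _≥_ l × All (1 ≤_) l

isPartition? : Decidable IsPartition
isPartition? l = linked? (λ x y → y ℕ.≤? x) l ×-dec all? (1 ℕ.≤?_) l

isPartition-irrelevant : Irrelevant IsPartition
isPartition-irrelevant (dec₁ , pos₁) (dec₂ , pos₂) =
  cong₂ _,_ (Linked.irrelevant ℕ.≤-irrelevant dec₁ dec₂) (All.irrelevant ℕ.≤-irrelevant pos₁ pos₂)

open Subtype isPartition? isPartition-irrelevant
  renaming (filterΣ to filterPartitions; ∈-filterΣ to ∈-filterPartitions; ≡-decΣ to ≡-decPartition)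

partition-≟ : DecidableEquality Partition
partition-≟ = ≡-decPartition (List.≡-dec ℕ._≟_)

length≤sum : ∀ (l : List ℕ) → All (1 ≤_) l → length l ≤ sum l
length≤sum []      []        = z≤n
length≤sum (x ∷ l) (1≤x ∷ pos) = ℕ.+-mono-≤ 1≤x (length≤sum l pos)

entries≤sum : ∀ (l : List ℕ) → All (_≤ sum l) l
entries≤sum []      = []
entries≤sum (x ∷ l) = ℕ.m≤m+n x (sum l) ∷ All.map (λ p → ℕ.≤-trans p (ℕ.m≤n+m (sum l) x)) (entries≤sum l)

partitionsUpTo : ℕ → List Partition
partitionsUpTo N = filterPartitions (boundedLists N N)

∈-partitionsUpTo : ∀ {N} (μ : Partition) → size μ ≤ N → μ ∈ partitionsUpTo N
∈-partitionsUpTo (l , isPart) |μ|≤N = ∈-filterPartitions isPart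
  (∈-boundedLists l (ℕ.≤-trans (length≤sum l (proj₂ isPart)) |μ|≤N)
                    (All.map (λ p → ℕ.≤-trans p |μ|≤N) (entries≤sum l)))

integersUpTo : ℕ → List ℤ
integersUpTo m = map +_ (upTo (suc m)) ++ map -[1+_] (upTo m)

∈-integersUpTo : ∀ {m} (d : ℤ) → ∣ d ∣ ≤ m → d ∈ integersUpTo m
∈-integersUpTo     (+ n)    n≤m = ∈-++⁺ˡ (∈-map⁺ +_ (∈-upTo⁺ (s≤s n≤m)))
∈-integersUpTo {m} -[1+ n ] n<m = ∈-++⁺ʳ (map +_ (upTo (suc m))) (∈-map⁺ -[1+_] (∈-upTo⁺ n<m))

suc-C2 : ∀ n → suc n C 2 ≡ n ℕ.+ n C 2
suc-C2 n = trans (sym (nCk+nC[k+1]≡[n+1]C[k+1] n 1)) (cong (ℕ._+ n C 2) (nC1≡n n))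

double-C2 : ∀ n → 2 ℕ.* (n C 2) ℕ.+ n ≡ n ℕ.* n
double-C2 zero    = refl
double-C2 (suc n) = begin
  2 ℕ.* (suc n C 2) ℕ.+ suc n         ≡⟨ cong (λ c → 2 ℕ.* c ℕ.+ suc n) (suc-C2 n) ⟩
  2 ℕ.* (n ℕ.+ n C 2) ℕ.+ suc n       ≡⟨ regroup n (n C 2) ⟩
  (2 ℕ.* (n C 2) ℕ.+ n) ℕ.+ (2 ℕ.* n ℕ.+ 1) ≡⟨ cong (ℕ._+ (2 ℕ.* n ℕ.+ 1)) (double-C2 n) ⟩
  n ℕ.* n ℕ.+ (2 ℕ.* n ℕ.+ 1)         ≡⟨ square n ⟩
  suc n ℕ.* suc n                     ∎
  where
  open ≡-Reasoning
  regroup : ∀ n c → 2 ℕ.* (n ℕ.+ c) ℕ.+ suc n ≡ (2 ℕ.* c ℕ.+ n) ℕ.+ (2 ℕ.* n ℕ.+ 1)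
  regroup = ℕ-Ring.solve-∀
  square : ∀ n → n ℕ.* n ℕ.+ (2 ℕ.* n ℕ.+ 1) ≡ suc n ℕ.* suc n
  square = ℕ-Ring.solve-∀

pos-double-C2 : ∀ n → + 2 * + (n C 2) ≡ + n * + n - + n
pos-double-C2 n = begin
  + 2 * + (n C 2)                 ≡⟨ add-sub (+ 2 * + (n C 2)) (+ n) ⟩
  + 2 * + (n C 2) + + n - + n     ≡⟨ cong (λ z → z + + n - + n) (sym (ℤ.pos-* 2 (n C 2))) ⟩
  + (2 ℕ.* (n C 2) ℕ.+ n) - + n   ≡⟨ cong (λ m → + m - + n) (double-C2 n) ⟩
  + (n ℕ.* n) - + n               ≡⟨ cong (_- + n) (ℤ.pos-* n n) ⟩
  + n * + n - + n                 ∎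
  where
  open ≡-Reasoning
  add-sub : ∀ a b → a ≡ a + b - b
  add-sub = ℤ-Ring.solve-∀

-- 2·binom(d,2) = d² - d for every integer d; for d = -(n+1) this is the
-- identity for n+2, since binom(-(n+1),2) = binom(n+2,2).
choose2-double : ∀ d → + 2 * choose2 d ≡ d * d - d
choose2-double (+ n)    = pos-double-C2 n
choose2-double -[1+ n ] = begin
  + 2 * + (suc (suc n) C 2)                    ≡⟨ pos-double-C2 (suc (suc n)) ⟩
  (+ 2 + + n) * (+ 2 + + n) - (+ 2 + + n)      ≡⟨ reflect (+ n) ⟩
  - (+ 1 + + n) * - (+ 1 + + n) - - (+ 1 + + n) ∎
  where
  open ≡-Reasoning
  reflect : ∀ b → (+ 2 + b) * (+ 2 + b) - (+ 2 + b) ≡ - (+ 1 + b) * - (+ 1 + b) - - (+ 1 + b)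
  reflect = ℤ-Ring.solve-∀

-- For odd s, half s is the k with s = 2k + 1.
half : ℤ → ℤ
half (+ n)    = + (n / 2)
half -[1+ n ] = -[1+ suc n / 2 ]

odd-ℕ : ∀ {n} → n % 2 ≡ 1 → n ≡ 1 ℕ.+ (n / 2) ℕ.* 2
odd-ℕ {n} odd = trans (m≡m%n+[m/n]*n n 2) (cong (ℕ._+ (n / 2) ℕ.* 2) odd)

pos-1+q*2 : ∀ q → + (1 ℕ.+ q ℕ.* 2) ≡ + 1 + + q * + 2
pos-1+q*2 q = cong (_+_ (+ 1)) (ℤ.pos-* q 2)

odd⇒2half+1 : ∀ s → OddZ s → s ≡ + 2 * half s + + 1
odd⇒2half+1 (+ n) odd = begin
  + n                          ≡⟨ cong +_ (odd-ℕ odd) ⟩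
  + (1 ℕ.+ (n / 2) ℕ.* 2)      ≡⟨ pos-1+q*2 (n / 2) ⟩
  + 1 + + (n / 2) * + 2        ≡⟨ rearrange (+ (n / 2)) ⟩
  + 2 * + (n / 2) + + 1        ∎
  where
  open ≡-Reasoning
  rearrange : ∀ q → + 1 + q * + 2 ≡ + 2 * q + + 1
  rearrange = ℤ-Ring.solve-∀
odd⇒2half+1 -[1+ n ] odd = begin
  - + suc n                          ≡⟨ cong (λ m → - + m) (odd-ℕ odd) ⟩
  - + (1 ℕ.+ (suc n / 2) ℕ.* 2)      ≡⟨ cong -_ (pos-1+q*2 (suc n / 2)) ⟩
  - (+ 1 + + (suc n / 2) * + 2)      ≡⟨ rearrange (+ (suc n / 2)) ⟩
  + 2 * - (+ 1 + + (suc n / 2)) + + 1 ∎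
  where
  open ≡-Reasoning
  rearrange : ∀ q → - (+ 1 + q * + 2) ≡ + 2 * - (+ 1 + q) + + 1
  rearrange = ℤ-Ring.solve-∀

-- Conversely 2k + 1 is odd: its absolute value is 1 + 2m for m = k or m = -k - 1.
2k+1-odd : ∀ k → OddZ (+ 2 * k + + 1)
2k+1-odd (+ m) = begin
  ∣ + 2 * + m + + 1 ∣ % 2  ≡⟨ cong (λ z → ∣ z ∣ % 2) (trans (rearrange (+ m)) (sym (pos-1+q*2 m))) ⟩
  (1 ℕ.+ m ℕ.* 2) % 2      ≡⟨ [m+kn]%n≡m%n 1 m 2 ⟩
  1                        ∎
  where
  open ≡-Reasoning
  rearrange : ∀ q → + 2 * q + + 1 ≡ + 1 + q * + 2
  rearrange = ℤ-Ring.solve-∀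
2k+1-odd -[1+ m ] = begin
  ∣ + 2 * -[1+ m ] + + 1 ∣ % 2    ≡⟨ cong (λ z → ∣ z ∣ % 2) (trans (rearrange (+ m)) (cong -_ (sym (pos-1+q*2 m)))) ⟩
  ∣ - + (1 ℕ.+ m ℕ.* 2) ∣ % 2     ≡⟨ cong (_% 2) (ℤ.∣-i∣≡∣i∣ (+ (1 ℕ.+ m ℕ.* 2))) ⟩
  (1 ℕ.+ m ℕ.* 2) % 2             ≡⟨ [m+kn]%n≡m%n 1 m 2 ⟩
  1                               ∎
  where
  open ≡-Reasoning
  rearrange : ∀ q → + 2 * - (+ 1 + q) + + 1 ≡ - (+ 1 + q * + 2)
  rearrange = ℤ-Ring.solve-∀

2k+1-injective : ∀ {a b} → + 2 * a + + 1 ≡ + 2 * b + + 1 → a ≡ b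
2k+1-injective {a} {b} eq = ℤ.*-cancelˡ-≡ (+ 2) a b (begin
  + 2 * a              ≡⟨ drop-1 a ⟩
  + 2 * a + + 1 - + 1  ≡⟨ cong (_- + 1) eq ⟩
  + 2 * b + + 1 - + 1  ≡⟨ drop-1 b ⟨
  + 2 * b              ∎)
  where
  open ≡-Reasoning
  drop-1 : ∀ a → + 2 * a ≡ + 2 * a + + 1 - + 1
  drop-1 = ℤ-Ring.solve-∀

half-2k+1 : ∀ k → half (+ 2 * k + + 1) ≡ k
half-2k+1 k = 2k+1-injective (sym (odd⇒2half+1 (+ 2 * k + + 1) (2k+1-odd k)))

vanish : ∀ {a b q s t} → a ≡ b + q * (s - t) → s ≡ t → a ≡ b
vanish {a} {b} {q} {s} eq refl = trans eq (drop b q s)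
  where
  drop : ∀ b q s → b + q * (s - s) ≡ b
  drop = ℤ-Ring.solve-∀

Tuple : Set
Tuple = Partition × Partition × Partition × Partition × ℤ × ℤ × ℤ × ℤ

weight : ℤ → ℤ → ℤ → ℤ → ℤ → ℕ → ℤ → ℤ → ℤ → ℤ → ℤ
weight c₀ c₁ c₂ c₃ c₄ S d₁ d₂ d₃ d₄ =
  + 14 * + S + + 14 * (choose2 d₁ + choose2 d₂ + choose2 d₃ + choose2 d₄)
    + c₁ * d₁ + c₂ * d₂ + c₃ * d₃ + c₄ * d₄ + c₀

dsum : Tuple → ℤ
dsum (_ , _ , _ , _ , d₁ , d₂ , d₃ , d₄) = d₁ + d₂ + d₃ + d₄

weightOf : ℤ → ℤ → ℤ → ℤ → ℤ → Tuple → ℤ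
weightOf c₀ c₁ c₂ c₃ c₄ (μ₁ , μ₂ , μ₃ , μ₄ , d₁ , d₂ , d₃ , d₄) =
  weight c₀ c₁ c₂ c₃ c₄ (size μ₁ ℕ.+ size μ₂ ℕ.+ size μ₃ ℕ.+ size μ₄) d₁ d₂ d₃ d₄

-- The defining condition of Tuples c₀ … c₄ N; indeed Tuples c₀ … c₄ N is
-- definitionally Σ Tuple (IsSolution c₀ … c₄ N).
IsSolution : ℤ → ℤ → ℤ → ℤ → ℤ → ℕ → Tuple → Set
IsSolution c₀ c₁ c₂ c₃ c₄ N x = OddZ (dsum x) × weightOf c₀ c₁ c₂ c₃ c₄ x ≡ + N

IsSolutionA IsSolutionB : ℕ → Tuple → Set
IsSolutionA = IsSolution (+ 0) (+ 1) (+ 3) (+ 5) (+ 7)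
IsSolutionB = IsSolution (+ 1) (+ 0) (+ 2) (+ 4) (+ 6)

isSolution? : ∀ c₀ c₁ c₂ c₃ c₄ N → Decidable (IsSolution c₀ c₁ c₂ c₃ c₄ N)
isSolution? c₀ c₁ c₂ c₃ c₄ N x = (∣ dsum x ∣ % 2 ℕ.≟ 1) ×-dec (weightOf c₀ c₁ c₂ c₃ c₄ x ℤ.≟ + N)

isSolution-irrelevant : ∀ c₀ c₁ c₂ c₃ c₄ N → Irrelevant (IsSolution c₀ c₁ c₂ c₃ c₄ N)
isSolution-irrelevant c₀ c₁ c₂ c₃ c₄ N (odd₁ , w₁) (odd₂ , w₂) =
  cong₂ _,_ (ℕ.≡-irrelevant odd₁ odd₂) (Decidable⇒UIP.≡-irrelevant ℤ._≟_ w₁ w₂)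

tuple-≟ : DecidableEquality Tuple
tuple-≟ = Product.≡-dec partition-≟ (Product.≡-dec partition-≟ (Product.≡-dec partition-≟ (Product.≡-dec partition-≟
            (Product.≡-dec ℤ._≟_ (Product.≡-dec ℤ._≟_ (Product.≡-dec ℤ._≟_ ℤ._≟_))))))

shiftBy : ℤ → Tuple → Tuple
shiftBy k (μ₁ , μ₂ , μ₃ , μ₄ , d₁ , d₂ , d₃ , d₄) = (μ₁ , μ₂ , μ₃ , μ₄ , d₁ - k , d₂ - k , d₃ - k , d₄ - k)

sub-sub-neg : ∀ d k → d - k - - k ≡ d
sub-sub-neg = ℤ-Ring.solve-∀

shiftBy-cancel : ∀ k x → shiftBy (- k) (shiftBy k x) ≡ x
shiftBy-cancel k (μ₁ , μ₂ , μ₃ , μ₄ , d₁ , d₂ , d₃ , d₄)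
  rewrite sub-sub-neg d₁ k | sub-sub-neg d₂ k | sub-sub-neg d₃ k | sub-sub-neg d₄ k = refl

dsum-shiftBy : ∀ k x → dsum x ≡ + 2 * k + + 1 → dsum (shiftBy k x) ≡ + 2 * - k + + 1
dsum-shiftBy k (μ₁ , μ₂ , μ₃ , μ₄ , d₁ , d₂ , d₃ , d₄) = vanish {q = + 1} (expand d₁ d₂ d₃ d₄ k)
  where
  expand : ∀ d₁ d₂ d₃ d₄ k → (d₁ - k) + (d₂ - k) + (d₃ - k) + (d₄ - k)
         ≡ (+ 2 * - k + + 1) + + 1 * ((d₁ + d₂ + d₃ + d₄) - (+ 2 * k + + 1))
  expand = ℤ-Ring.solve-∀

shift : Tuple → Tuple
shift x = shiftBy (half (dsum x)) x

shift-odd : ∀ x → OddZ (dsum x) → OddZ (dsum (shift x))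
shift-odd x odd = subst OddZ (sym (dsum-shiftBy k x (odd⇒2half+1 (dsum x) odd))) (2k+1-odd (- k))
  where
  k : ℤ
  k = half (dsum x)

-- Since half (2(-k) + 1) = -k, the second shift undoes the first.
shift-involutive : ∀ x → OddZ (dsum x) → shift (shift x) ≡ x
shift-involutive x odd = begin
  shiftBy (half (dsum (shiftBy k x))) (shiftBy k x) ≡⟨ cong (λ j → shiftBy j (shiftBy k x)) half-shifted ⟩
  shiftBy (- k) (shiftBy k x)                       ≡⟨ shiftBy-cancel k x ⟩
  x                                                 ∎
  where
  open ≡-Reasoning
  k : ℤ
  k = half (dsum x)
  half-shifted : half (dsum (shiftBy k x)) ≡ - k
  half-shifted = trans (cong half (dsum-shiftBy k x (odd⇒2half+1 (dsum x) odd))) (half-2k+1 (- k))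

-- Twice the weight, with 2·binom(d,2) replaced by d² - d: a polynomial in all arguments.
doubledWeight : ℤ → ℤ → ℤ → ℤ → ℤ → ℕ → ℤ → ℤ → ℤ → ℤ → ℤ
doubledWeight c₀ c₁ c₂ c₃ c₄ S d₁ d₂ d₃ d₄ =
  + 28 * + S + + 14 * ((d₁ * d₁ - d₁) + (d₂ * d₂ - d₂) + (d₃ * d₃ - d₃) + (d₄ * d₄ - d₄))
    + + 2 * (c₁ * d₁ + c₂ * d₂ + c₃ * d₃ + c₄ * d₄ + c₀)

weight-double : ∀ c₀ c₁ c₂ c₃ c₄ S d₁ d₂ d₃ d₄ →
                + 2 * weight c₀ c₁ c₂ c₃ c₄ S d₁ d₂ d₃ d₄ ≡ doubledWeight c₀ c₁ c₂ c₃ c₄ S d₁ d₂ d₃ d₄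
weight-double c₀ c₁ c₂ c₃ c₄ S d₁ d₂ d₃ d₄ = begin
  + 2 * weight c₀ c₁ c₂ c₃ c₄ S d₁ d₂ d₃ d₄
    ≡⟨ distribute c₀ c₁ c₂ c₃ c₄ (+ S) (choose2 d₁) (choose2 d₂) (choose2 d₃) (choose2 d₄) d₁ d₂ d₃ d₄ ⟩
  + 28 * + S + + 14 * (+ 2 * choose2 d₁ + + 2 * choose2 d₂ + + 2 * choose2 d₃ + + 2 * choose2 d₄) + + 2 * L
    ≡⟨ cong (λ t → + 28 * + S + + 14 * t + + 2 * L)
            (cong₂ _+_ (cong₂ _+_ (cong₂ _+_ (choose2-double d₁) (choose2-double d₂)) (choose2-double d₃))
                       (choose2-double d₄)) ⟩
  doubledWeight c₀ c₁ c₂ c₃ c₄ S d₁ d₂ d₃ d₄ ∎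
  where
  open ≡-Reasoning
  L : ℤ
  L = c₁ * d₁ + c₂ * d₂ + c₃ * d₃ + c₄ * d₄ + c₀
  distribute : ∀ c₀ c₁ c₂ c₃ c₄ T a₁ a₂ a₃ a₄ d₁ d₂ d₃ d₄ →
    + 2 * (+ 14 * T + + 14 * (a₁ + a₂ + a₃ + a₄) + c₁ * d₁ + c₂ * d₂ + c₃ * d₃ + c₄ * d₄ + c₀)
    ≡ + 28 * T + + 14 * (+ 2 * a₁ + + 2 * a₂ + + 2 * a₃ + + 2 * a₄) + + 2 * (c₁ * d₁ + c₂ * d₂ + c₃ * d₃ + c₄ * d₄ + c₀)
  distribute = ℤ-Ring.solve-∀

shift-polynomial : ∀ S k d₁ d₂ d₃ d₄ →
  doubledWeight (+ 1) (+ 0) (+ 2) (+ 4) (+ 6) S (d₁ - k) (d₂ - k) (d₃ - k) (d₄ - k)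
  ≡ doubledWeight (+ 0) (+ 1) (+ 3) (+ 5) (+ 7) S d₁ d₂ d₃ d₄
    + - (+ 2 * (+ 14 * k + + 1)) * ((d₁ + d₂ + d₃ + d₄) - (+ 2 * k + + 1))
shift-polynomial S k d₁ d₂ d₃ d₄ = expand (+ S) k d₁ d₂ d₃ d₄
  where
  expand : ∀ T k d₁ d₂ d₃ d₄ →
    + 28 * T + + 14 * (((d₁ - k) * (d₁ - k) - (d₁ - k)) + ((d₂ - k) * (d₂ - k) - (d₂ - k))
                       + ((d₃ - k) * (d₃ - k) - (d₃ - k)) + ((d₄ - k) * (d₄ - k) - (d₄ - k)))
      + + 2 * (+ 0 * (d₁ - k) + + 2 * (d₂ - k) + + 4 * (d₃ - k) + + 6 * (d₄ - k) + + 1)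
    ≡ + 28 * T + + 14 * ((d₁ * d₁ - d₁) + (d₂ * d₂ - d₂) + (d₃ * d₃ - d₃) + (d₄ * d₄ - d₄))
      + + 2 * (+ 1 * d₁ + + 3 * d₂ + + 5 * d₃ + + 7 * d₄ + + 0)
      + - (+ 2 * (+ 14 * k + + 1)) * ((d₁ + d₂ + d₃ + d₄) - (+ 2 * k + + 1))
  expand = ℤ-Ring.solve-∀

weight-shift : ∀ k x → dsum x ≡ + 2 * k + + 1 →
               weightOf (+ 1) (+ 0) (+ 2) (+ 4) (+ 6) (shiftBy k x) ≡ weightOf (+ 0) (+ 1) (+ 3) (+ 5) (+ 7) x
weight-shift k (μ₁ , μ₂ , μ₃ , μ₄ , d₁ , d₂ , d₃ , d₄) sum-odd = ℤ.*-cancelˡ-≡ (+ 2) _ _ (begin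
  + 2 * weight (+ 1) (+ 0) (+ 2) (+ 4) (+ 6) S (d₁ - k) (d₂ - k) (d₃ - k) (d₄ - k)
    ≡⟨ weight-double (+ 1) (+ 0) (+ 2) (+ 4) (+ 6) S (d₁ - k) (d₂ - k) (d₃ - k) (d₄ - k) ⟩
  doubledWeight (+ 1) (+ 0) (+ 2) (+ 4) (+ 6) S (d₁ - k) (d₂ - k) (d₃ - k) (d₄ - k)
    ≡⟨ vanish {q = - (+ 2 * (+ 14 * k + + 1))} (shift-polynomial S k d₁ d₂ d₃ d₄) sum-odd ⟩
  doubledWeight (+ 0) (+ 1) (+ 3) (+ 5) (+ 7) S d₁ d₂ d₃ d₄
    ≡⟨ weight-double (+ 0) (+ 1) (+ 3) (+ 5) (+ 7) S d₁ d₂ d₃ d₄ ⟨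
  + 2 * weight (+ 0) (+ 1) (+ 3) (+ 5) (+ 7) S d₁ d₂ d₃ d₄ ∎)
  where
  open ≡-Reasoning
  S : ℕ
  S = size μ₁ ℕ.+ size μ₂ ℕ.+ size μ₃ ℕ.+ size μ₄

shift-A→B : ∀ N x → IsSolutionA N x → IsSolutionB N (shift x)
shift-A→B N x (odd , weight≡N) =
  shift-odd x odd , trans (weight-shift (half (dsum x)) x (odd⇒2half+1 (dsum x) odd)) weight≡N

-- ... and back: x is recovered from y = shift x by shifting by -k, and the sum
-- of y is 2(-k) + 1, so weight-shift applies to y.
shift-B→A : ∀ N x → IsSolutionB N x → IsSolutionA N (shift x)
shift-B→A N x (odd , weight≡N) = shift-odd x odd , (begin
  weightOf (+ 0) (+ 1) (+ 3) (+ 5) (+ 7) y                    ≡⟨ weight-shift (- k) y sum-y ⟨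
  weightOf (+ 1) (+ 0) (+ 2) (+ 4) (+ 6) (shiftBy (- k) y)    ≡⟨ cong (weightOf (+ 1) (+ 0) (+ 2) (+ 4) (+ 6)) (shiftBy-cancel k x) ⟩
  weightOf (+ 1) (+ 0) (+ 2) (+ 4) (+ 6) x                    ≡⟨ weight≡N ⟩
  + N                                                         ∎)
  where
  open ≡-Reasoning
  k : ℤ
  k = half (dsum x)
  y : Tuple
  y = shiftBy k x
  sum-y : dsum y ≡ + 2 * - k + + 1
  sum-y = dsum-shiftBy k x (odd⇒2half+1 (dsum x) odd)

shift-bijection : ∀ N → Σ Tuple (IsSolutionA N) ↔ Σ Tuple (IsSolutionB N)
shift-bijection N = involution-bijection {P = IsSolutionA N} {Q = IsSolutionB N} shift
  (λ {x} → isSolution-irrelevant (+ 0) (+ 1) (+ 3) (+ 5) (+ 7) N {x})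
  (λ {x} → isSolution-irrelevant (+ 1) (+ 0) (+ 2) (+ 4) (+ 6) N {x})
  (shift-A→B N) (shift-B→A N)
  (λ x sol → shift-involutive x (proj₁ sol)) (λ x sol → shift-involutive x (proj₁ sol))

-- The contribution 14·binom(d,2) + c·d of one integer d to the weight, as a
-- natural number (for c < 14 the negative branch does not truncate).
term : ℕ → ℤ → ℕ
term c (+ n)    = 14 ℕ.* (n C 2) ℕ.+ c ℕ.* n
term c -[1+ n ] = 14 ℕ.* (suc (suc n) C 2) ℕ.∸ c ℕ.* suc n

-- (1 + c)(n + 1) ≤ 14·binom(n+2,2) for c < 14, since n + 1 ≤ binom(n+2,2).
negative-term-bound : ∀ c n → c < 14 → suc c ℕ.* suc n ≤ 14 ℕ.* (suc (suc n) C 2)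
negative-term-bound c n c<14 =
  ℕ.*-mono-≤ c<14 (ℕ.≤-trans (ℕ.m≤m+n (suc n) (suc n C 2)) (ℕ.≤-reflexive (sym (suc-C2 (suc n)))))

term-correct : ∀ c → c < 14 → ∀ d → + 14 * choose2 d + + c * d ≡ + term c d
term-correct c _ (+ n) = cong₂ _+_ (sym (ℤ.pos-* 14 (n C 2))) (sym (ℤ.pos-* c n))
term-correct c c<14 -[1+ n ] = begin
  + 14 * + m + + c * - + suc n           ≡⟨ cong₂ _+_ (sym (ℤ.pos-* 14 m)) (sym (ℤ.neg-distribʳ-* (+ c) (+ suc n))) ⟩
  + (14 ℕ.* m) - + c * + suc n           ≡⟨ cong (λ z → + (14 ℕ.* m) - z) (sym (ℤ.pos-* c (suc n))) ⟩
  + (14 ℕ.* m) - + (c ℕ.* suc n)         ≡⟨ ℤ.m-n≡m⊖n (14 ℕ.* m) (c ℕ.* suc n) ⟩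
  (14 ℕ.* m) ℤ.⊖ (c ℕ.* suc n)           ≡⟨ ℤ.⊖-≥ (ℕ.m+n≤o⇒n≤o (suc n) (negative-term-bound c n c<14)) ⟩
  + (14 ℕ.* m ℕ.∸ c ℕ.* suc n)           ∎
  where
  open ≡-Reasoning
  m : ℕ
  m = suc (suc n) C 2

term-bound : ∀ c → .{{NonZero c}} → c < 14 → ∀ d → ∣ d ∣ ≤ term c d
term-bound c _     (+ n)    = ℕ.≤-trans (ℕ.m≤n*m n c) (ℕ.m≤n+m (c ℕ.* n) (14 ℕ.* (n C 2)))
term-bound c c<14 -[1+ n ] = ℕ.m+n≤o⇒m≤o∸n (suc n) (negative-term-bound c n c<14)

weightA-terms : ∀ S d₁ d₂ d₃ d₄ → weight (+ 0) (+ 1) (+ 3) (+ 5) (+ 7) S d₁ d₂ d₃ d₄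
                ≡ + (14 ℕ.* S ℕ.+ term 1 d₁ ℕ.+ term 3 d₂ ℕ.+ term 5 d₃ ℕ.+ term 7 d₄)
weightA-terms S d₁ d₂ d₃ d₄ = begin
  weight (+ 0) (+ 1) (+ 3) (+ 5) (+ 7) S d₁ d₂ d₃ d₄
    ≡⟨ regroup (+ S) (choose2 d₁) (choose2 d₂) (choose2 d₃) (choose2 d₄) d₁ d₂ d₃ d₄ ⟩
  + 14 * + S + piece 1 d₁ + piece 3 d₂ + piece 5 d₃ + piece 7 d₄
    ≡⟨ cong₂ _+_ (cong₂ _+_ (cong₂ _+_ (cong₂ _+_ (sym (ℤ.pos-* 14 S))
         (term-correct 1 (ℕ.m≤m+n 2 12) d₁)) (term-correct 3 (ℕ.m≤m+n 4 10) d₂))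
         (term-correct 5 (ℕ.m≤m+n 6 8) d₃)) (term-correct 7 (ℕ.m≤m+n 8 6) d₄) ⟩
  + (14 ℕ.* S ℕ.+ term 1 d₁ ℕ.+ term 3 d₂ ℕ.+ term 5 d₃ ℕ.+ term 7 d₄) ∎
  where
  open ≡-Reasoning
  piece : ℕ → ℤ → ℤ
  piece c d = + 14 * choose2 d + + c * d
  regroup : ∀ T a₁ a₂ a₃ a₄ d₁ d₂ d₃ d₄ →
    + 14 * T + + 14 * (a₁ + a₂ + a₃ + a₄) + + 1 * d₁ + + 3 * d₂ + + 5 * d₃ + + 7 * d₄ + + 0
    ≡ + 14 * T + (+ 14 * a₁ + + 1 * d₁) + (+ 14 * a₂ + + 3 * d₂) + (+ 14 * a₃ + + 5 * d₃) + (+ 14 * a₄ + + 7 * d₄)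
  regroup = ℤ-Ring.solve-∀

summands≤ : ∀ {a b c d N} → a ℕ.+ b ℕ.+ c ℕ.+ d ≤ N → a ≤ N × b ≤ N × c ≤ N × d ≤ N
summands≤ {a} {b} {c} abcd≤N =
  let abc≤N = ℕ.m+n≤o⇒m≤o (a ℕ.+ b ℕ.+ c) abcd≤N
      ab≤N  = ℕ.m+n≤o⇒m≤o (a ℕ.+ b) abc≤N
  in ℕ.m+n≤o⇒m≤o a ab≤N , ℕ.m+n≤o⇒n≤o a ab≤N , ℕ.m+n≤o⇒n≤o (a ℕ.+ b) abc≤N , ℕ.m+n≤o⇒n≤o (a ℕ.+ b ℕ.+ c) abcd≤N

Bounded : ℕ → Tuple → Set
Bounded N (μ₁ , μ₂ , μ₃ , μ₄ , d₁ , d₂ , d₃ , d₄) =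
  size μ₁ ≤ N × size μ₂ ≤ N × size μ₃ ≤ N × size μ₄ ≤ N × ∣ d₁ ∣ ≤ N × ∣ d₂ ∣ ≤ N × ∣ d₃ ∣ ≤ N × ∣ d₄ ∣ ≤ N

-- A solution of weight N with coefficients (0,1,3,5,7) is bounded by N:
-- every term of the weight is a natural number bounding the corresponding entry.
solutionA-bounded : ∀ N x → IsSolutionA N x → Bounded N x
solutionA-bounded N (μ₁ , μ₂ , μ₃ , μ₄ , d₁ , d₂ , d₃ , d₄) (_ , weight≡N) =
  let total≤N = ℕ.≤-reflexive (ℤ.+-injective (trans (sym (weightA-terms S d₁ d₂ d₃ d₄)) weight≡N))
      (14S≤N , t₁≤N , t₂≤N , t₃≤N) = summands≤ (ℕ.m+n≤o⇒m≤o (14 ℕ.* S ℕ.+ term 1 d₁ ℕ.+ term 3 d₂ ℕ.+ term 5 d₃) total≤N)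
      t₄≤N = ℕ.m+n≤o⇒n≤o (14 ℕ.* S ℕ.+ term 1 d₁ ℕ.+ term 3 d₂ ℕ.+ term 5 d₃) total≤N
      (s₁≤N , s₂≤N , s₃≤N , s₄≤N) = summands≤ (ℕ.≤-trans (ℕ.m≤n*m S 14) 14S≤N)
  in s₁≤N , s₂≤N , s₃≤N , s₄≤N
     , ℕ.≤-trans (term-bound 1 (ℕ.m≤m+n 2 12) d₁) t₁≤N , ℕ.≤-trans (term-bound 3 (ℕ.m≤m+n 4 10) d₂) t₂≤N
     , ℕ.≤-trans (term-bound 5 (ℕ.m≤m+n 6 8) d₃) t₃≤N , ℕ.≤-trans (term-bound 7 (ℕ.m≤m+n 8 6) d₄) t₄≤N
  where
  S : ℕ
  S = size μ₁ ℕ.+ size μ₂ ℕ.+ size μ₃ ℕ.+ size μ₄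

candidates : ℕ → List Tuple
candidates N = cartesianProduct Ps (cartesianProduct Ps (cartesianProduct Ps (cartesianProduct Ps
                 (cartesianProduct Zs (cartesianProduct Zs (cartesianProduct Zs Zs))))))
  where
  Ps : List Partition
  Ps = partitionsUpTo N
  Zs : List ℤ
  Zs = integersUpTo N

∈-candidates : ∀ N x → Bounded N x → x ∈ candidates N
∈-candidates N (μ₁ , μ₂ , μ₃ , μ₄ , d₁ , d₂ , d₃ , d₄) (b₁ , b₂ , b₃ , b₄ , b₅ , b₆ , b₇ , b₈) =
  ∈-cartesianProduct⁺ (∈-partitionsUpTo μ₁ b₁) (∈-cartesianProduct⁺ (∈-partitionsUpTo μ₂ b₂)
  (∈-cartesianProduct⁺ (∈-partitionsUpTo μ₃ b₃) (∈-cartesianProduct⁺ (∈-partitionsUpTo μ₄ b₄)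
  (∈-cartesianProduct⁺ (∈-integersUpTo d₁ b₅) (∈-cartesianProduct⁺ (∈-integersUpTo d₂ b₆)
  (∈-cartesianProduct⁺ (∈-integersUpTo d₃ b₇) (∈-integersUpTo d₄ b₈)))))))

solutionsA-finite : ∀ N → ∃[ k ] (Σ Tuple (IsSolutionA N) ↔ Fin k)
solutionsA-finite N = Subtype.subtype-finite (isSolution? (+ 0) (+ 1) (+ 3) (+ 5) (+ 7) N)
  (λ {x} → isSolution-irrelevant (+ 0) (+ 1) (+ 3) (+ 5) (+ 7) N {x})
  tuple-≟ (candidates N) (λ {x} sol → ∈-candidates N x (solutionA-bounded N x sol))

lemma3p1 : (N : ℕ) → N ≥ 1 →
  Σ ℕ (λ k → (Tuples (+ 0) (+ 1) (+ 3) (+ 5) (+ 7) N ↔ Fin k)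
           × (Tuples (+ 1) (+ 0) (+ 2) (+ 4) (+ 6) N ↔ Fin k))
lemma3p1 N _ = k , A↔Fin , ↔-trans (↔-sym (shift-bijection N)) A↔Fin
  where
  k : ℕ
  k = proj₁ (solutionsA-finite N)
  A↔Fin : Σ Tuple (IsSolutionA N) ↔ Fin k
  A↔Fin = proj₂ (solutionsA-finite N)
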